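{- Let $f: L \rightarrow M$ be an arrow in $\mathbf{OA}$; then (1) $f$ is an epimorphism if and only if $f^\dagger$ is a monomorphism; (2) if $f$ is surjective, then $f$ is an epimorphism; (3) classically (assuming the law of excluded middle), if $f$ is an epimorphism, then $f$ is surjective.
   Context: Work in intuitionistic logic without choice. A positivity predicate on a complete lattice $L$ is a unary predicate $\mathrm{Pos}$ such that: (i) $\mathrm{Pos}(x)$ and $x\le y$ imply $\mathrm{Pos}(y)$; (ii) $\mathrm{Pos}(\bigvee X)$ implies $\mathrm{Pos}(x)$ for some $x\in X$; (iii) if $\mathrm{Pos}(x)\Rightarrow x\le y$, then $x\le y$. An o-algebra is a frame $L$ with a positivity predicate such that for all $x,y$: if $\mathrm{Pos}(z\wedge x)\Rightarrow\mathrm{Pos}(z\wedge y)$ for every $z\in L$, then $x\le y$. Write $x\bowtie y$ (overlap) for $\mathrm{Pos}(x\wedge y)$. Functions $f:L\to M$, $g:M\to L$ are symmetric if $f(x)\bowtie y\iff x\bowtie g(y)$; $f$ is symmetrizable if it has a (unique) symmetric $f^\dagger$. $\mathbf{OA}$ is the category of o-algebras and symmetrizable functions; it is a dagger category via $f\mapsto f^\dagger$. -}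

module Defs where

open import Level using (Level; suc; _⊔_)
open import Data.Product using (Σ; _×_; _,_; proj₁; proj₂; ∃)
open import Data.Sum using (_⊎_)
open import Relation.Nullary using (¬_)
open import Relation.Binary.PropositionalEquality using (_≡_)
open import Function.Bundles using (_⇔_)

Subset : ∀ {ℓ} → Set ℓ → Set (suc ℓ)
Subset {ℓ} A = A → Set ℓ

record Frame (ℓ : Level) : Set (suc ℓ) where
  infix 4 _≤_
  infixr 7 _∧_
  field
    Carrier  : Set ℓ
    _≤_      : Carrier → Carrier → Set ℓ
    ≤-refl   : ∀ {x} → x ≤ x
    ≤-trans  : ∀ {x y z} → x ≤ y → y ≤ z → x ≤ z
    ≤-antisym : ∀ {x y} → x ≤ y → y ≤ x → x ≡ y
    ⋁        : Subset Carrier → Carrier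
    ⋁-ub     : ∀ (X : Subset Carrier) {x} → X x → x ≤ ⋁ X
    ⋁-least  : ∀ (X : Subset Carrier) {y} → (∀ x → X x → x ≤ y) → ⋁ X ≤ y
    _∧_      : Carrier → Carrier → Carrier
    ∧-lb₁    : ∀ {x y} → x ∧ y ≤ x
    ∧-lb₂    : ∀ {x y} → x ∧ y ≤ y
    ∧-glb    : ∀ {x y z} → z ≤ x → z ≤ y → z ≤ x ∧ y
    -- frame distributivity: x ∧ ⋁X = ⋁ { x ∧ y | y ∈ X }
    ∧-⋁-distrib : ∀ x (X : Subset Carrier) →
      x ∧ ⋁ X ≡ ⋁ (λ z → Σ Carrier (λ y → X y × (z ≡ x ∧ y)))

record OAlg (ℓ : Level) : Set (suc ℓ) where
  field
    frame : Frame ℓ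
  open Frame frame public
  field
    Pos       : Carrier → Set ℓ
    Pos-mono  : ∀ {x y} → Pos x → x ≤ y → Pos y
    Pos-⋁     : ∀ (X : Subset Carrier) → Pos (⋁ X) → Σ Carrier (λ x → X x × Pos x)
    Pos-pos   : ∀ {x y} → (Pos x → x ≤ y) → x ≤ y
    separate  : ∀ x y → (∀ z → Pos (z ∧ x) → Pos (z ∧ y)) → x ≤ y

  _⋈_ : Carrier → Carrier → Set ℓ
  x ⋈ y = Pos (x ∧ y)

open OAlg using (Carrier)

module _ {ℓ} (L M : OAlg ℓ) where
  private
    module L = OAlg L
    module M = OAlg M

  Symmetric : (L.Carrier → M.Carrier) → (M.Carrier → L.Carrier) → Set ℓ
  Symmetric f g = ∀ x y → (f x M.⋈ y) ⇔ (x L.⋈ g y)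

  Symmetrizable : (L.Carrier → M.Carrier) → Set ℓ
  Symmetrizable f = Σ (M.Carrier → L.Carrier) (Symmetric f)

  Hom : Set ℓ
  Hom = Σ (L.Carrier → M.Carrier) Symmetrizable

fun : ∀ {ℓ} (L M : OAlg ℓ) → Hom L M → Carrier L → Carrier M
fun L M f = proj₁ f

dagger : ∀ {ℓ} (L M : OAlg ℓ) → Hom L M → Carrier M → Carrier L
dagger L M f = proj₁ (proj₂ f)

-- Epimorphism / monomorphism in OA (for a function that is an arrow of OA),
-- tested against all parallel pairs of OA-arrows; equality of arrows is
-- extensional (pointwise) equality of the underlying functions.
IsEpi : ∀ {ℓ} (L M : OAlg ℓ) → (Carrier L → Carrier M) → Set (suc ℓ)
IsEpi {ℓ} L M f = ∀ (N : OAlg ℓ) (g h : Hom M N) →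
  (∀ x → fun M N g (f x) ≡ fun M N h (f x)) → ∀ y → fun M N g y ≡ fun M N h y

IsMono : ∀ {ℓ} (L M : OAlg ℓ) → (Carrier L → Carrier M) → Set (suc ℓ)
IsMono {ℓ} L M f = ∀ (N : OAlg ℓ) (g h : Hom N L) →
  (∀ x → f (fun N L g x) ≡ f (fun N L h x)) → ∀ x → fun N L g x ≡ fun N L h x

Surjective : ∀ {ℓ} {A B : Set ℓ} → (A → B) → Set ℓ
Surjective {A = A} f = ∀ y → ∃ (λ x → f x ≡ y)

LEM : (ℓ : Level) → Set (suc ℓ)
LEM ℓ = (P : Set ℓ) → P ⊎ ¬ P

module Submission where

-- (1) is pure dagger-category reasoning: an arrow is determined by its
--     dagger, and (g ∘ f)† = f† ∘ g†, so g ∘ f = h ∘ f iff f† ∘ g† = f† ∘ h†.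
-- (2) holds for any function: a surjection is right-cancellable.
-- (3) proceeds in three steps.
--   (a) Every mono of OA is injective, constructively: for each element a
--       the "guarded" arrow x ↦ (a if Pos x) is an OA-arrow whose value at
--       the top element is a, and symmetrizable maps commute with guards.
--   (b) Classically each element b has an involutive complement ¬b, the
--       join of everything disjoint from b, and then r y = ¬ f†(¬ y) is a
--       right adjoint of f:  x ≤ r y  ⇔  f x ≤ y.
--   (c) If f† is injective then so is r, and an injective right adjoint
--       makes f surjective, because r (f (r y)) = r y.
-- By (1), an epi f has a mono, hence injective, dagger, so (3) follows.

open import Defs
open import Data.Product using (Σ; _×_; _,_; proj₂; map₂; swap)
open import Data.Sum using (inj₁; inj₂)
open import Data.Empty using (⊥-elim)
open import Data.Unit.Polymorphic using (⊤; tt)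
open import Function.Base using (_∘_)
open import Function.Bundles using (_⇔_; mk⇔; Equivalence)
open import Relation.Nullary using (¬_)
open import Relation.Binary.PropositionalEquality
  using (_≡_; refl; sym; cong; subst; module ≡-Reasoning)

open Equivalence using (to; from)

module OAlgebraFacts {ℓ} (O : OAlg ℓ) where
  open OAlg O

  ⋈-sym : ∀ {x y} → x ⋈ y → y ⋈ x
  ⋈-sym p = Pos-mono p (∧-glb ∧-lb₂ ∧-lb₁)

  ⋈-monoˡ : ∀ {x x' y} → x ≤ x' → x ⋈ y → x' ⋈ y
  ⋈-monoˡ x≤x' p = Pos-mono p (∧-glb (≤-trans ∧-lb₁ x≤x') ∧-lb₂)

  ⋈⇒Pos : ∀ {x y} → x ⋈ y → Pos y
  ⋈⇒Pos p = Pos-mono p ∧-lb₂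

  ⋈-ext : ∀ {a b} → (∀ z → (z ⋈ a) ⇔ (z ⋈ b)) → a ≡ b
  ⋈-ext same = ≤-antisym (separate _ _ (to ∘ same)) (separate _ _ (from ∘ same))

  ⋈-⋁ : ∀ {x} (X : Subset Carrier) → (x ⋈ ⋁ X) ⇔ Σ Carrier (λ w → X w × x ⋈ w)
  ⋈-⋁ {x} X = mk⇔ pick (λ (w , Xw , p) → Pos-mono p (∧-glb ∧-lb₁ (≤-trans ∧-lb₂ (⋁-ub X Xw))))
    where
    pick : x ⋈ ⋁ X → Σ Carrier (λ w → X w × x ⋈ w)
    pick p with Pos-⋁ _ (subst Pos (∧-⋁-distrib x X) p)
    ... | _ , (w , Xw , refl) , q = w , Xw , q

  top : Carrier
  top = ⋁ (λ _ → ⊤)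

  ⋈-top : ∀ {x} → (x ⋈ top) ⇔ Pos x
  ⋈-top = mk⇔ (λ p → Pos-mono p ∧-lb₁) (λ p → Pos-mono p (∧-glb ≤-refl (⋁-ub _ tt)))

  -- guard P a = ⋁ { a | P } is "a if P holds", without deciding P.
  guard : Set ℓ → Carrier → Carrier
  guard P a = ⋁ (λ w → P × w ≡ a)

  ⋈-guard : ∀ {P a z} → (z ⋈ guard P a) ⇔ (P × z ⋈ a)
  ⋈-guard {P} {a} {z} = mk⇔ unguard (λ (π , p) → from (⋈-⋁ _) (a , (π , refl) , p))
    where
    unguard : z ⋈ guard P a → P × z ⋈ a
    unguard p with to (⋈-⋁ _) p
    ... | _ , (π , refl) , q = π , q

  guard-redundant : ∀ {P a} → (Pos a → P) → guard P a ≡ a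
  guard-redundant Pos⇒P = ⋈-ext λ z →
    mk⇔ (proj₂ ∘ to ⋈-guard) (λ p → from ⋈-guard (Pos⇒P (⋈⇒Pos p) , p))

  neg : Carrier → Carrier
  neg b = ⋁ (λ w → ¬ (w ⋈ b))

  neg-disjoint : ∀ {b} → ¬ (neg b ⋈ b)
  neg-disjoint p with to (⋈-⋁ _) (⋈-sym p)
  ... | _ , w⋈̸b , b⋈w = w⋈̸b (⋈-sym b⋈w)

  ≤-neg : ∀ {a b} → (a ≤ neg b) ⇔ (¬ a ⋈ b)
  ≤-neg = mk⇔ (λ a≤¬b a⋈b → neg-disjoint (⋈-monoˡ a≤¬b a⋈b)) (⋁-ub _)

  module Classical (lem : LEM ℓ) where
    open ≡-Reasoning

    neg-involutive : ∀ y → neg (neg y) ≡ y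
    neg-involutive y = ≤-antisym (separate _ _ meets-y) (from ≤-neg (neg-disjoint ∘ ⋈-sym))
      where
      meets-y : ∀ z → z ⋈ neg (neg y) → z ⋈ y
      meets-y z p with lem (z ⋈ y)
      ... | inj₁ z⋈y = z⋈y
      ... | inj₂ z⋈̸y = ⊥-elim (neg-disjoint (⋈-sym (⋈-monoˡ (from ≤-neg z⋈̸y) p)))

    neg-injective : ∀ {a b} → neg a ≡ neg b → a ≡ b
    neg-injective {a} {b} e = begin
      a             ≡⟨ sym (neg-involutive a) ⟩
      neg (neg a)   ≡⟨ cong neg e ⟩
      neg (neg b)   ≡⟨ neg-involutive b ⟩
      b             ∎

-- Order theory (only the partial orders of the frames are used): if f ⊣ r
-- and r is injective, then f ∘ r = id, since r (f (r y)) = r y.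
module GaloisConnection {ℓ} (A B : Frame ℓ) where
  private
    module A = Frame A
    module B = Frame B

  injective-right-adjoint⇒section :
    {f : A.Carrier → B.Carrier} {r : B.Carrier → A.Carrier} →
    (∀ {x y} → (x A.≤ r y) ⇔ (f x B.≤ y)) →
    (∀ {y y'} → r y ≡ r y' → y ≡ y') →
    ∀ y → f (r y) ≡ y
  injective-right-adjoint⇒section {f} {r} adj r-injective y = r-injective r-fixes
    where
    counit : ∀ {y} → f (r y) B.≤ y
    counit = to adj A.≤-refl

    r-mono : ∀ {y y'} → y B.≤ y' → r y A.≤ r y'
    r-mono y≤y' = from adj (B.≤-trans counit y≤y')

    r-fixes : r (f (r y)) ≡ r y
    r-fixes = A.≤-antisym (r-mono counit) (from adj B.≤-refl)

module SymmetricMaps {ℓ} (L M : OAlg ℓ) where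
  private
    module L = OAlg L
    module M = OAlg M
    module LF = OAlgebraFacts L
    module MF = OAlgebraFacts M

  ⋈-adjoint : ∀ {f g} → Symmetric L M f g → ∀ {x z} → (z M.⋈ f x) ⇔ (g z L.⋈ x)
  ⋈-adjoint {f} {g} fg {x} {z} = mk⇔
    (LF.⋈-sym ∘ to (fg x z) ∘ MF.⋈-sym)
    (MF.⋈-sym ∘ from (fg x z) ∘ LF.⋈-sym)

  symmetric-unique : ∀ {f f' g g'} → Symmetric L M f g → Symmetric L M f' g' →
    (∀ y → g y ≡ g' y) → ∀ x → f x ≡ f' x
  symmetric-unique fg f'g' g≗g' x = MF.⋈-ext λ z → mk⇔
    (from (⋈-adjoint f'g') ∘ subst (L._⋈ x) (g≗g' z) ∘ to (⋈-adjoint fg))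
    (from (⋈-adjoint fg) ∘ subst (L._⋈ x) (sym (g≗g' z)) ∘ to (⋈-adjoint f'g'))

  -- Symmetrizable maps commute with guards (they preserve all joins).
  symmetric-guard : ∀ {f g} → Symmetric L M f g →
    ∀ {P a} → f (LF.guard P a) ≡ MF.guard P (f a)
  symmetric-guard fg = MF.⋈-ext λ z → mk⇔
    (from MF.⋈-guard ∘ map₂ (from (⋈-adjoint fg)) ∘ to LF.⋈-guard ∘ to (⋈-adjoint fg))
    (from (⋈-adjoint fg) ∘ from LF.⋈-guard ∘ map₂ (to (⋈-adjoint fg)) ∘ to MF.⋈-guard)

-- The dagger of an arrow and composition of arrows; as in Defs, the
-- objects are explicit since they cannot be inferred from Hom.
dag : ∀ {ℓ} (L M : OAlg ℓ) → Hom L M → Hom M L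
dag L M (f , g , fg) = g , f , λ y x → mk⇔
  (OAlgebraFacts.⋈-sym M ∘ from (fg x y) ∘ OAlgebraFacts.⋈-sym L)
  (OAlgebraFacts.⋈-sym L ∘ to (fg x y) ∘ OAlgebraFacts.⋈-sym M)

comp : ∀ {ℓ} (L M N : OAlg ℓ) → Hom M N → Hom L M → Hom L N
comp L M N (g , g† , gg†) (f , f† , ff†) = g ∘ f , f† ∘ g† , λ x z → mk⇔
  (to (ff† x (g† z)) ∘ to (gg† (f x) z))
  (from (gg† (f x) z) ∘ from (ff† x (g† z)))

dagger-determines : ∀ {ℓ} (L M : OAlg ℓ) (u v : Hom L M) →
  (∀ y → dagger L M u y ≡ dagger L M v y) → ∀ x → fun L M u x ≡ fun L M v x
dagger-determines L M (_ , _ , uu†) (_ , _ , vv†) = SymmetricMaps.symmetric-unique L M uu† vv†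

epi⇒dagger-mono : ∀ {ℓ} (L M : OAlg ℓ) (f : Hom L M) →
  IsEpi L M (fun L M f) → IsMono M L (dagger L M f)
epi⇒dagger-mono L M f epi N g h f†g≗f†h =
  dagger-determines N M g h (epi N (dag N M g) (dag N M h)
    (dagger-determines L N (comp L M N (dag N M g) f) (comp L M N (dag N M h) f) f†g≗f†h))

dagger-mono⇒epi : ∀ {ℓ} (L M : OAlg ℓ) (f : Hom L M) →
  IsMono M L (dagger L M f) → IsEpi L M (fun L M f)
dagger-mono⇒epi L M f mono N g h gf≗hf =
  dagger-determines M N g h (mono N (dag M N g) (dag M N h)
    (dagger-determines N L (dag L N (comp L M N g f)) (dag L N (comp L M N h f)) gf≗hf))

surjective⇒epi : ∀ {ℓ} (L M : OAlg ℓ) {f : OAlg.Carrier L → OAlg.Carrier M} →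
  Surjective f → IsEpi L M f
surjective⇒epi L M surj N g h gf≗hf y with surj y
... | x , refl = gf≗hf x

guardedArrow : ∀ {ℓ} (O : OAlg ℓ) → OAlg.Carrier O → Hom O O
guardedArrow O a = (λ x → guard (Pos x) a) , (λ y → guard (y ⋈ a) top) , λ x y →
  mk⇔ (from ⋈-guard ∘ map₂ (from ⋈-top) ∘ swap ∘ to ⋈-guard ∘ ⋈-sym)
      (⋈-sym ∘ from ⋈-guard ∘ swap ∘ map₂ (to ⋈-top) ∘ to ⋈-guard)
  where
  open OAlg O
  open OAlgebraFacts O

-- Testing against guarded arrows shows that every mono of OA is injective.
mono⇒injective : ∀ {ℓ} (L M : OAlg ℓ) (f : Hom L M) → IsMono L M (fun L M f) →
  ∀ {a b} → fun L M f a ≡ fun L M f b → a ≡ b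
mono⇒injective L M (f , _ , fg) mono {a} {b} fa≡fb = begin
  a                     ≡⟨ sym (guard-top a) ⟩
  guard (Pos top) a     ≡⟨ mono L (guardedArrow L a) (guardedArrow L b) agree top ⟩
  guard (Pos top) b     ≡⟨ guard-top b ⟩
  b                     ∎
  where
  open ≡-Reasoning
  open OAlg L
  open OAlgebraFacts L
  module MF = OAlgebraFacts M

  guard-top : ∀ c → guard (Pos top) c ≡ c
  guard-top c = guard-redundant (λ p → Pos-mono p (⋁-ub _ tt))

  agree : ∀ x → f (guard (Pos x) a) ≡ f (guard (Pos x) b)
  agree x = begin
    f (guard (Pos x) a)       ≡⟨ SymmetricMaps.symmetric-guard L M fg ⟩
    MF.guard (Pos x) (f a)    ≡⟨ cong (MF.guard (Pos x)) fa≡fb ⟩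
    MF.guard (Pos x) (f b)    ≡⟨ sym (SymmetricMaps.symmetric-guard L M fg) ⟩
    f (guard (Pos x) b)       ∎

module ClassicalArrow {ℓ} (lem : LEM ℓ) (L M : OAlg ℓ) (f : Hom L M) where
  private
    module L = OAlg L
    module M = OAlg M
    module LF = OAlgebraFacts L
    module MF = OAlgebraFacts M
    module LC = LF.Classical lem
    module MC = MF.Classical lem

  F : L.Carrier → M.Carrier
  F = fun L M f

  F† : M.Carrier → L.Carrier
  F† = dagger L M f

  F-symmetric : Symmetric L M F F†
  F-symmetric = proj₂ (proj₂ f)

  right : M.Carrier → L.Carrier
  right y = LF.neg (F† (MF.neg y))

  -- x ≤ ¬F†(¬y)  ⇔  ¬ (x ⋈ F†(¬y))  ⇔  ¬ (F x ⋈ ¬y)  ⇔  F x ≤ ¬¬y = y.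
  right-adjoint : ∀ {x y} → (x L.≤ right y) ⇔ (F x M.≤ y)
  right-adjoint {x} {y} = mk⇔
    (λ x≤ry → subst (F x M.≤_) (MC.neg-involutive y)
       (from MF.≤-neg (to LF.≤-neg x≤ry ∘ to (F-symmetric x (MF.neg y)))))
    (λ Fx≤y → from LF.≤-neg (to MF.≤-neg (subst (F x M.≤_) (sym (MC.neg-involutive y)) Fx≤y)
       ∘ from (F-symmetric x (MF.neg y))))

  injective-dagger⇒surjective : (∀ {a b} → F† a ≡ F† b → a ≡ b) → Surjective F
  injective-dagger⇒surjective F†-injective y =
    right y , GaloisConnection.injective-right-adjoint⇒section (OAlg.frame L) (OAlg.frame M)
      right-adjoint (MC.neg-injective ∘ F†-injective ∘ LC.neg-injective) y

proposition4p5 : ∀ {ℓ} {L M : OAlg ℓ} (f : Hom L M) →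
    (IsEpi L M (fun L M f) ⇔ IsMono M L (dagger L M f))
    × (Surjective (fun L M f) → IsEpi L M (fun L M f))
    × (LEM ℓ → IsEpi L M (fun L M f) → Surjective (fun L M f))
proposition4p5 {L = L} {M} f =
  mk⇔ (epi⇒dagger-mono L M f) (dagger-mono⇒epi L M f) ,
  surjective⇒epi L M ,
  λ lem epi → ClassicalArrow.injective-dagger⇒surjective lem L M f
    (mono⇒injective M L (dag L M f) (epi⇒dagger-mono L M f epi))
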